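{- $\text{E-HA}^{\omega*}_{\mathrm{st}} + \mathsf{US}^* \vdash \mathsf{HGMP}^{\mathrm{st}}$, where $\mathsf{US}^*$ is the schema $\forall s:\sigma^*\,(\mathrm{hyper}_\sigma(s) \to \varphi(s)) \to \exists^{\mathrm{st}} s:\sigma^* \,\varphi(s)$ (all types, all internal $\varphi$) and $\mathsf{HGMP}^{\mathrm{st}}$ is the schema $(\forall^{\mathrm{st}} x:\sigma \, \varphi(x) \to \psi) \to \exists^{\mathrm{st}} s: \sigma^* \, (\forall x \in s \, \varphi(x) \to \psi)$ for all types $\sigma$ and internal formulae $\varphi,\psi$.
   Context: $\text{E-HA}^{\omega*}$ is extensional Heyting arithmetic in all finite types over the types generated by $0$, $\sigma\to\tau$ and $\sigma^*$ (finite sequences), with constants for the empty sequence, prepending, a list recursor, and the axiom that every sequence is empty or a prepend; $|s|$, $s_i$, $s\cdot t$ denote length, projection, concatenation, and $a\in s :\equiv \exists i<|s|\,(a=s_i)$. $\text{E-HA}^{\omega*}_{\mathrm{st}}$ adds predicates $\mathrm{st}_\sigma$ and external quantifiers $\forall^{\mathrm{st}}x\,\Phi :\leftrightarrow \forall x(\mathrm{st}(x)\to\Phi)$, $\exists^{\mathrm{st}}x\,\Phi :\leftrightarrow \exists x(\mathrm{st}(x)\land\Phi)$; internal formulae are those not containing $\mathrm{st}$. Axioms: those of $\text{E-HA}^{\omega*}$ (induction only for internal formulae), $\mathrm{st}(x)\land x=y\to\mathrm{st}(y)$, $\mathrm{st}(a)$ for closed terms $a$, $\mathrm{st}(f)\land\mathrm{st}(x)\to\mathrm{st}(fx)$,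 and external induction for all formulae. $\mathrm{hyper}_\sigma(s) :\equiv \forall^{\mathrm{st}}x:\sigma\,(x\in s)$. -}

module Defs where

open import Data.List using (List; []; _∷_; map)
open import Data.List.Membership.Propositional using (_∈_)

infixr 6 _⇒_
infixl 9 _·_

data Ty : Set where
  N   : Ty
  _⇒_ : Ty → Ty → Ty
  _*  : Ty → Ty

-- contexts: the head is the most recently bound variable
Ctx : Set
Ctx = List Ty

data _∋_ : Ctx → Ty → Set where
  here  : ∀ {Γ σ} → (σ ∷ Γ) ∋ σ
  there : ∀ {Γ σ τ} → Γ ∋ σ → (τ ∷ Γ) ∋ σ

data Const : Ty → Set where
  zero' : Const N
  suc'  : Const (N ⇒ N)
  Π'    : ∀ {ρ σ} → Const (ρ ⇒ σ ⇒ ρ)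
  Σ'    : ∀ {ρ σ τ} → Const ((ρ ⇒ σ ⇒ τ) ⇒ (ρ ⇒ σ) ⇒ ρ ⇒ τ)
  R'    : ∀ {σ} → Const (σ ⇒ (σ ⇒ N ⇒ σ) ⇒ N ⇒ σ)
  nil'  : ∀ {σ} → Const (σ *)
  cons' : ∀ {σ} → Const (σ ⇒ σ * ⇒ σ *)
  L'    : ∀ {σ ρ} → Const (ρ ⇒ (σ ⇒ σ * ⇒ ρ ⇒ ρ) ⇒ σ * ⇒ ρ)

data Tm (Γ : Ctx) : Ty → Set where
  var : ∀ {σ} → Γ ∋ σ → Tm Γ σ
  con : ∀ {σ} → Const σ → Tm Γ σ
  _·_ : ∀ {σ τ} → Tm Γ (σ ⇒ τ) → Tm Γ σ → Tm Γ τ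

Ren : Ctx → Ctx → Set
Ren Γ Δ = ∀ {σ} → Γ ∋ σ → Δ ∋ σ

extR : ∀ {Γ Δ τ} → Ren Γ Δ → Ren (τ ∷ Γ) (τ ∷ Δ)
extR ρ here      = here
extR ρ (there x) = there (ρ x)

renT : ∀ {Γ Δ σ} → Ren Γ Δ → Tm Γ σ → Tm Δ σ
renT ρ (var x) = var (ρ x)
renT ρ (con c) = con c
renT ρ (f · a) = renT ρ f · renT ρ a

wkT : ∀ {Γ σ τ} → Tm Γ σ → Tm (τ ∷ Γ) σ
wkT = renT there

Sub : Ctx → Ctx → Set
Sub Γ Δ = ∀ {σ} → Γ ∋ σ → Tm Δ σ

extS : ∀ {Γ Δ τ} → Sub Γ Δ → Sub (τ ∷ Γ) (τ ∷ Δ)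
extS s here      = var here
extS s (there x) = wkT (s x)

subT : ∀ {Γ Δ σ} → Sub Γ Δ → Tm Γ σ → Tm Δ σ
subT s (var x) = s x
subT s (con c) = con c
subT s (f · a) = subT s f · subT s a

-- bracket abstraction (λ-abstraction definable from Π, Σ)
lam : ∀ {Γ σ τ} → Tm (σ ∷ Γ) τ → Tm Γ (σ ⇒ τ)
lam {σ = σ} (var here) = con (Σ' {σ} {σ ⇒ σ} {σ}) · con Π' · con (Π' {σ} {σ})
lam (var (there x)) = con Π' · var x
lam (con c)         = con Π' · con c
lam (f · a)         = con Σ' · lam f · lam a

closed : ∀ {Γ σ} → Tm [] σ → Tm Γ σ
closed = renT (λ ())

-- Formulae of E-HA^{ω*}_st (prime equality only at type 0)

infixr 3 _⊃_
infixr 4 _∨'_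
infixr 5 _∧'_
infix  7 _≐_

data Fm (Γ : Ctx) : Set where
  ⊥'   : Fm Γ
  _≐_  : Tm Γ N → Tm Γ N → Fm Γ
  St   : ∀ {σ} → Tm Γ σ → Fm Γ
  _∧'_ : Fm Γ → Fm Γ → Fm Γ
  _∨'_ : Fm Γ → Fm Γ → Fm Γ
  _⊃_  : Fm Γ → Fm Γ → Fm Γ
  ∀'   : (σ : Ty) → Fm (σ ∷ Γ) → Fm Γ
  ∃'   : (σ : Ty) → Fm (σ ∷ Γ) → Fm Γ

renF : ∀ {Γ Δ} → Ren Γ Δ → Fm Γ → Fm Δ
renF ρ ⊥'       = ⊥'
renF ρ (a ≐ b)  = renT ρ a ≐ renT ρ b
renF ρ (St a)   = St (renT ρ a)
renF ρ (φ ∧' ψ) = renF ρ φ ∧' renF ρ ψ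
renF ρ (φ ∨' ψ) = renF ρ φ ∨' renF ρ ψ
renF ρ (φ ⊃ ψ)  = renF ρ φ ⊃ renF ρ ψ
renF ρ (∀' σ φ) = ∀' σ (renF (extR ρ) φ)
renF ρ (∃' σ φ) = ∃' σ (renF (extR ρ) φ)

wkF : ∀ {Γ τ} → Fm Γ → Fm (τ ∷ Γ)
wkF = renF there

subF : ∀ {Γ Δ} → Sub Γ Δ → Fm Γ → Fm Δ
subF s ⊥'       = ⊥'
subF s (a ≐ b)  = subT s a ≐ subT s b
subF s (St a)   = St (subT s a)
subF s (φ ∧' ψ) = subF s φ ∧' subF s ψ
subF s (φ ∨' ψ) = subF s φ ∨' subF s ψ
subF s (φ ⊃ ψ)  = subF s φ ⊃ subF s ψ
subF s (∀' σ φ) = ∀' σ (subF (extS s) φ)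
subF s (∃' σ φ) = ∃' σ (subF (extS s) φ)

sub1 : ∀ {Γ σ} → Tm Γ σ → Sub (σ ∷ Γ) Γ
sub1 t here      = t
sub1 t (there x) = var x

_[_] : ∀ {Γ σ} → Fm (σ ∷ Γ) → Tm Γ σ → Fm Γ
φ [ t ] = subF (sub1 t) φ

stepS : ∀ {Γ} → Sub (N ∷ Γ) (N ∷ Γ)
stepS here      = con suc' · var here
stepS (there x) = var (there x)

¬' : ∀ {Γ} → Fm Γ → Fm Γ
¬' φ = φ ⊃ ⊥'

data Internal {Γ : Ctx} : Fm Γ → Set where
  i⊥ : Internal ⊥'
  i≐ : ∀ {a b} → Internal (a ≐ b)
  i∧ : ∀ {φ ψ} → Internal φ → Internal ψ → Internal (φ ∧' ψ)
  i∨ : ∀ {φ ψ} → Internal φ → Internal ψ → Internal (φ ∨' ψ)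
  i⊃ : ∀ {φ ψ} → Internal φ → Internal ψ → Internal (φ ⊃ ψ)
  i∀ : ∀ {σ φ} → Internal {σ ∷ Γ} φ → Internal (∀' σ φ)
  i∃ : ∀ {σ φ} → Internal {σ ∷ Γ} φ → Internal (∃' σ φ)

∀st : ∀ {Γ} (σ : Ty) → Fm (σ ∷ Γ) → Fm Γ
∀st σ Φ = ∀' σ (St (var here) ⊃ Φ)

∃st : ∀ {Γ} (σ : Ty) → Fm (σ ∷ Γ) → Fm Γ
∃st σ Φ = ∃' σ (St (var here) ∧' Φ)

zeroT : ∀ {Γ} (σ : Ty) → Tm Γ σ
zeroT N       = con zero'
zeroT (σ ⇒ τ) = con Π' · zeroT τ
zeroT (σ *)   = con nil'

-- i + k  (recursion on k)
plusT : ∀ {Γ} → Tm Γ N → Tm Γ N → Tm Γ N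
plusT i k = con R' · i · lam (lam (con suc' · var (there here))) · k

-- |s| := L 0 (λ x t n. S n) s
lenT : ∀ {Γ σ} → Tm Γ (σ *) → Tm Γ N
lenT {σ = σ} s = con (L' {σ} {N}) · con zero' · (con Π' · (con Π' · con suc')) · s

-- s_i  (default value 0^σ when i ≥ |s|):
-- s_i := L (λ i. 0^σ) (λ x t h. R x (λ u j. h j)) s i
projT : ∀ {Γ σ} → Tm Γ (σ *) → Tm Γ N → Tm Γ σ
projT {σ = σ} s i =
  con (L' {σ} {N ⇒ σ}) · (con Π' · zeroT σ)
    · lam (lam (lam (con R' · var (there (there here)) · (con Π' · var here))))
    · s · i

ltF : ∀ {Γ} → Tm Γ N → Tm Γ N → Fm Γ
ltF i j = ∃' N (plusT (wkT i) (con suc' · var here) ≐ wkT j)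

eqF : ∀ {Γ} (σ : Ty) → Tm Γ σ → Tm Γ σ → Fm Γ
eqF N       a b = a ≐ b
eqF (σ ⇒ τ) f g = ∀' σ (eqF τ (wkT f · var here) (wkT g · var here))
eqF (σ *)   s t =
  (lenT s ≐ lenT t) ∧'
  ∀' N (ltF (var here) (lenT (wkT s)) ⊃
        eqF σ (projT (wkT s) (var here)) (projT (wkT t) (var here)))

memF : ∀ {Γ σ} → Tm Γ σ → Tm Γ (σ *) → Fm Γ
memF {σ = σ} a s =
  ∃' N (ltF (var here) (lenT (wkT s)) ∧' eqF σ (wkT a) (projT (wkT s) (var here)))

hyperF : ∀ {Γ} (σ : Ty) → Tm Γ (σ *) → Fm Γ
hyperF σ s = ∀st σ (memF (var here) (wkT s))

Theory : Set₁
Theory = (Γ : Ctx) → Fm Γ → Set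

data Der (T : Theory) : (Γ : Ctx) → List (Fm Γ) → Fm Γ → Set where
  hyp  : ∀ {Γ Δ φ} → φ ∈ Δ → Der T Γ Δ φ
  ax   : ∀ {Γ Δ φ} → T Γ φ → Der T Γ Δ φ
  ⊥E   : ∀ {Γ Δ φ} → Der T Γ Δ ⊥' → Der T Γ Δ φ
  ∧I   : ∀ {Γ Δ φ ψ} → Der T Γ Δ φ → Der T Γ Δ ψ → Der T Γ Δ (φ ∧' ψ)
  ∧E₁  : ∀ {Γ Δ φ ψ} → Der T Γ Δ (φ ∧' ψ) → Der T Γ Δ φ
  ∧E₂  : ∀ {Γ Δ φ ψ} → Der T Γ Δ (φ ∧' ψ) → Der T Γ Δ ψ
  ∨I₁  : ∀ {Γ Δ φ ψ} → Der T Γ Δ φ → Der T Γ Δ (φ ∨' ψ)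
  ∨I₂  : ∀ {Γ Δ φ ψ} → Der T Γ Δ ψ → Der T Γ Δ (φ ∨' ψ)
  ∨E   : ∀ {Γ Δ φ ψ χ} → Der T Γ Δ (φ ∨' ψ) →
         Der T Γ (φ ∷ Δ) χ → Der T Γ (ψ ∷ Δ) χ → Der T Γ Δ χ
  ⊃I   : ∀ {Γ Δ φ ψ} → Der T Γ (φ ∷ Δ) ψ → Der T Γ Δ (φ ⊃ ψ)
  ⊃E   : ∀ {Γ Δ φ ψ} → Der T Γ Δ (φ ⊃ ψ) → Der T Γ Δ φ → Der T Γ Δ ψ
  ∀I   : ∀ {Γ Δ σ φ} → Der T (σ ∷ Γ) (map wkF Δ) φ → Der T Γ Δ (∀' σ φ)
  ∀E   : ∀ {Γ Δ σ φ} → Der T Γ Δ (∀' σ φ) → (t : Tm Γ σ) → Der T Γ Δ (φ [ t ])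
  ∃I   : ∀ {Γ Δ σ φ} → (t : Tm Γ σ) → Der T Γ Δ (φ [ t ]) → Der T Γ Δ (∃' σ φ)
  ∃E   : ∀ {Γ Δ σ φ χ} → Der T Γ Δ (∃' σ φ) →
         Der T (σ ∷ Γ) (φ ∷ map wkF Δ) (wkF χ) → Der T Γ Δ χ

-- Axioms of E-HA^{ω*}_st (schemata; free variables act as parameters)

data EHAst : Theory where
  eq-refl  : ∀ {Γ} (a : Tm Γ N) → EHAst Γ (a ≐ a)
  eq-repl  : ∀ {Γ} (φ : Fm (N ∷ Γ)) → Internal φ → (a b : Tm Γ N) →
             EHAst Γ (a ≐ b ⊃ φ [ a ] ⊃ φ [ b ])
  ext      : ∀ {Γ σ τ} (z : Tm Γ (σ ⇒ τ)) (x y : Tm Γ σ) →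
             EHAst Γ (eqF σ x y ⊃ eqF τ (z · x) (z · y))
  suc≢0    : ∀ {Γ} (a : Tm Γ N) → EHAst Γ (¬' (con suc' · a ≐ con zero'))
  suc-inj  : ∀ {Γ} (a b : Tm Γ N) → EHAst Γ (con suc' · a ≐ con suc' · b ⊃ a ≐ b)
  Π-ax     : ∀ {Γ ρ σ} (x : Tm Γ ρ) (y : Tm Γ σ) → EHAst Γ (eqF ρ (con Π' · x · y) x)
  Σ-ax     : ∀ {Γ ρ σ τ} (x : Tm Γ (ρ ⇒ σ ⇒ τ)) (y : Tm Γ (ρ ⇒ σ)) (z : Tm Γ ρ) →
             EHAst Γ (eqF τ (con Σ' · x · y · z) (x · z · (y · z)))
  R-ax₀    : ∀ {Γ σ} (x : Tm Γ σ) (y : Tm Γ (σ ⇒ N ⇒ σ)) →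
             EHAst Γ (eqF σ (con R' · x · y · con zero') x)
  R-axS    : ∀ {Γ σ} (x : Tm Γ σ) (y : Tm Γ (σ ⇒ N ⇒ σ)) (z : Tm Γ N) →
             EHAst Γ (eqF σ (con R' · x · y · (con suc' · z)) (y · (con R' · x · y · z) · z))
  L-ax-nil : ∀ {Γ σ ρ} (x : Tm Γ ρ) (y : Tm Γ (σ ⇒ σ * ⇒ ρ ⇒ ρ)) →
             EHAst Γ (eqF ρ (con L' · x · y · con nil') x)
  L-ax-cons : ∀ {Γ σ ρ} (x : Tm Γ ρ) (y : Tm Γ (σ ⇒ σ * ⇒ ρ ⇒ ρ)) (a : Tm Γ σ) (s : Tm Γ (σ *)) →
             EHAst Γ (eqF ρ (con L' · x · y · (con cons' · a · s)) (y · a · s · (con L' · x · y · s)))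
  seq-ax   : ∀ {Γ σ} (s : Tm Γ (σ *)) →
             EHAst Γ (eqF (σ *) s (con nil') ∨'
                      ∃' σ (∃' (σ *) (eqF (σ *) (wkT (wkT s))
                                        (con cons' · var (there here) · var here))))
  ind      : ∀ {Γ} (φ : Fm (N ∷ Γ)) → Internal φ →
             EHAst Γ (φ [ con zero' ] ⊃ ∀' N (φ ⊃ subF stepS φ) ⊃ ∀' N φ)
  st-eq    : ∀ {Γ σ} (x y : Tm Γ σ) → EHAst Γ (St x ∧' eqF σ x y ⊃ St y)
  st-closed : ∀ {Γ σ} (a : Tm [] σ) → EHAst Γ (St (closed {Γ} a))
  st-app   : ∀ {Γ σ τ} (f : Tm Γ (σ ⇒ τ)) (x : Tm Γ σ) → EHAst Γ (St f ∧' St x ⊃ St (f · x))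
  ext-ind  : ∀ {Γ} (Φ : Fm (N ∷ Γ)) →
             EHAst Γ (Φ [ con zero' ] ⊃ ∀st N (Φ ⊃ subF stepS Φ) ⊃ ∀st N Φ)

data EHAst+US : Theory where
  base : ∀ {Γ φ} → EHAst Γ φ → EHAst+US Γ φ
  US*  : ∀ {Γ σ} (φ : Fm (σ * ∷ Γ)) → Internal φ →
         EHAst+US Γ (∀' (σ *) (hyperF σ (var here) ⊃ φ) ⊃ ∃st (σ *) φ)

-- insert a fresh variable (s) below the most recent one (x)
wkUnder : ∀ {Γ σ τ} → Ren (σ ∷ Γ) (σ ∷ τ ∷ Γ)
wkUnder = extR there

HGMPst : ∀ {Γ} (σ : Ty) → Fm (σ ∷ Γ) → Fm Γ → Fm Γ
HGMPst σ φ ψ =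
  (∀st σ φ ⊃ ψ) ⊃
  ∃st (σ *) (∀' σ (memF (var here) (var (there here)) ⊃ renF wkUnder φ) ⊃ wkF ψ)

module Submission where

-- Assume  ∀^st x φ(x) → ψ  and apply US* to the internal formula
--   χ(s) :≡ (∀x ∈ s φ(x)) → ψ.
-- It remains to show  ∀s (hyper(s) → χ(s)):  if s is hyperfinite and φ holds
-- on all members of s, then φ holds for every standard x (each standard x
-- lies in s), so the assumption yields ψ.  This part is pure logic and is
-- proved for an arbitrary theory.
--
-- The only syntactic fact needed is that instantiating the variable x of
-- renF wkUnder φ by the variable inserted beneath it gives back φ.

open import Data.List using (List; []; _∷_)
open import Data.List.Relation.Unary.Any using (here; there)
open import Relation.Binary.PropositionalEquality
  using (_≡_; refl; cong; cong₂; trans; subst; module ≡-Reasoning)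
open import Defs

private
  variable
    Γ Δ Θ : Ctx
    σ τ : Ty

_≗ˢ_ : Sub Γ Δ → Sub Γ Δ → Set
s ≗ˢ s' = ∀ {τ} (x : _ ∋ τ) → s x ≡ s' x

extS-ext : {s s' : Sub Γ Δ} → s ≗ˢ s' → extS {τ = τ} s ≗ˢ extS s'
extS-ext e here      = refl
extS-ext e (there x) = cong wkT (e x)

subT-ext : {s s' : Sub Γ Δ} → s ≗ˢ s' → (t : Tm Γ σ) → subT s t ≡ subT s' t
subT-ext e (var x) = e x
subT-ext e (con c) = refl
subT-ext e (f · a) = cong₂ _·_ (subT-ext e f) (subT-ext e a)

subF-ext : {s s' : Sub Γ Δ} → s ≗ˢ s' → (φ : Fm Γ) → subF s φ ≡ subF s' φ
subF-ext e ⊥'       = refl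
subF-ext e (a ≐ b)  = cong₂ _≐_ (subT-ext e a) (subT-ext e b)
subF-ext e (St a)   = cong St (subT-ext e a)
subF-ext e (φ ∧' ψ) = cong₂ _∧'_ (subF-ext e φ) (subF-ext e ψ)
subF-ext e (φ ∨' ψ) = cong₂ _∨'_ (subF-ext e φ) (subF-ext e ψ)
subF-ext e (φ ⊃ ψ)  = cong₂ _⊃_ (subF-ext e φ) (subF-ext e ψ)
subF-ext e (∀' σ φ) = cong (∀' σ) (subF-ext (extS-ext e) φ)
subF-ext e (∃' σ φ) = cong (∃' σ) (subF-ext (extS-ext e) φ)

extS-var : extS {Γ} {Γ} {τ} var ≗ˢ var
extS-var here      = refl
extS-var (there x) = refl

subT-id : (t : Tm Γ σ) → subT var t ≡ t
subT-id (var x) = refl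
subT-id (con c) = refl
subT-id (f · a) = cong₂ _·_ (subT-id f) (subT-id a)

subF-id : (φ : Fm Γ) → subF var φ ≡ φ
subF-id ⊥'       = refl
subF-id (a ≐ b)  = cong₂ _≐_ (subT-id a) (subT-id b)
subF-id (St a)   = cong St (subT-id a)
subF-id (φ ∧' ψ) = cong₂ _∧'_ (subF-id φ) (subF-id ψ)
subF-id (φ ∨' ψ) = cong₂ _∨'_ (subF-id φ) (subF-id ψ)
subF-id (φ ⊃ ψ)  = cong₂ _⊃_ (subF-id φ) (subF-id ψ)
subF-id (∀' σ φ) = cong (∀' σ) (trans (subF-ext extS-var φ) (subF-id φ))
subF-id (∃' σ φ) = cong (∃' σ) (trans (subF-ext extS-var φ) (subF-id φ))

subT-renT : (s : Sub Δ Θ) (ρ : Ren Γ Δ) (t : Tm Γ σ) →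
            subT s (renT ρ t) ≡ subT (λ x → s (ρ x)) t
subT-renT s ρ (var x) = refl
subT-renT s ρ (con c) = refl
subT-renT s ρ (f · a) = cong₂ _·_ (subT-renT s ρ f) (subT-renT s ρ a)

extS-extR : (s : Sub Δ Θ) (ρ : Ren Γ Δ) →
            (λ {υ} (x : (τ ∷ Γ) ∋ υ) → extS s (extR ρ x)) ≗ˢ extS (λ x → s (ρ x))
extS-extR s ρ here      = refl
extS-extR s ρ (there x) = refl

subF-renF : (s : Sub Δ Θ) (ρ : Ren Γ Δ) (φ : Fm Γ) →
            subF s (renF ρ φ) ≡ subF (λ x → s (ρ x)) φ
subF-renF s ρ ⊥'       = refl
subF-renF s ρ (a ≐ b)  = cong₂ _≐_ (subT-renT s ρ a) (subT-renT s ρ b)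
subF-renF s ρ (St a)   = cong St (subT-renT s ρ a)
subF-renF s ρ (φ ∧' ψ) = cong₂ _∧'_ (subF-renF s ρ φ) (subF-renF s ρ ψ)
subF-renF s ρ (φ ∨' ψ) = cong₂ _∨'_ (subF-renF s ρ φ) (subF-renF s ρ ψ)
subF-renF s ρ (φ ⊃ ψ)  = cong₂ _⊃_ (subF-renF s ρ φ) (subF-renF s ρ ψ)
subF-renF s ρ (∀' σ φ) =
  cong (∀' σ) (trans (subF-renF (extS s) (extR ρ) φ) (subF-ext (extS-extR s ρ) φ))
subF-renF s ρ (∃' σ φ) =
  cong (∃' σ) (trans (subF-renF (extS s) (extR ρ) φ) (subF-ext (extS-extR s ρ) φ))

wkUnder-instantiate : (φ : Fm (σ ∷ Γ)) → renF wkUnder φ [ var here ] ≡ φ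
wkUnder-instantiate φ = begin
  subF (sub1 (var here)) (renF wkUnder φ)   ≡⟨ subF-renF (sub1 (var here)) wkUnder φ ⟩
  subF (λ x → sub1 (var here) (wkUnder x)) φ ≡⟨ subF-ext collapse φ ⟩
  subF var φ                                ≡⟨ subF-id φ ⟩
  φ                                         ∎
  where
  open ≡-Reasoning
  collapse : (λ {υ} (x : (σ ∷ Γ) ∋ υ) → sub1 (var here) (wkUnder x)) ≗ˢ var
  collapse here      = refl
  collapse (there x) = refl

eqF-int : ∀ σ (a b : Tm Γ σ) → Internal (eqF σ a b)
eqF-int N       a b = i≐
eqF-int (σ ⇒ τ) f g = i∀ (eqF-int τ _ _)
eqF-int (σ *)   s t = i∧ i≐ (i∀ (i⊃ (i∃ i≐) (eqF-int σ _ _)))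

memF-int : (a : Tm Γ σ) (s : Tm Γ (σ *)) → Internal (memF a s)
memF-int {σ = σ} a s = i∃ (i∧ (i∃ i≐) (eqF-int σ _ _))

renF-int : (ρ : Ren Γ Δ) {φ : Fm Γ} → Internal φ → Internal (renF ρ φ)
renF-int ρ i⊥       = i⊥
renF-int ρ i≐       = i≐
renF-int ρ (i∧ p q) = i∧ (renF-int ρ p) (renF-int ρ q)
renF-int ρ (i∨ p q) = i∨ (renF-int ρ p) (renF-int ρ q)
renF-int ρ (i⊃ p q) = i⊃ (renF-int ρ p) (renF-int ρ q)
renF-int ρ (i∀ p)   = i∀ (renF-int (extR ρ) p)
renF-int ρ (i∃ p)   = i∃ (renF-int (extR ρ) p)

boundedAll : (σ : Ty) → Fm (σ ∷ Γ) → Fm (σ * ∷ Γ)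
boundedAll σ φ = ∀' σ (memF (var here) (var (there here)) ⊃ renF wkUnder φ)

hgmpMatrix : (σ : Ty) → Fm (σ ∷ Γ) → Fm Γ → Fm (σ * ∷ Γ)
hgmpMatrix σ φ ψ = boundedAll σ φ ⊃ wkF ψ

hgmpMatrix-int : {φ : Fm (σ ∷ Γ)} {ψ : Fm Γ} →
                 Internal φ → Internal ψ → Internal (hgmpMatrix σ φ ψ)
hgmpMatrix-int iφ iψ =
  i⊃ (i∀ (i⊃ (memF-int _ _) (renF-int wkUnder iφ))) (renF-int there iψ)

-- If s is hyperfinite and φ holds on all members of s, then φ holds for
-- every standard x: a standard x is a member of s.
hyper-bounded⇒standard : ∀ {T} (φ : Fm (σ ∷ Γ)) {Δ : List (Fm (σ * ∷ Γ))} →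
  Der T (σ * ∷ Γ) (boundedAll σ φ ∷ hyperF σ (var here) ∷ Δ) (wkF (∀st σ φ))
hyper-bounded⇒standard {σ = σ} {T = T} φ = ∀I (⊃I (⊃E instanceφ x∈s))
  where
  Δx : List (Fm (σ ∷ σ * ∷ _))
  Δx = St (var here) ∷ _

  x∈s : Der T _ Δx (memF (var here) (var (there here)))
  x∈s = subst (Der T _ Δx) (wkUnder-instantiate (memF (var here) (var (there here))))
          (⊃E (∀E (hyp (there (there (here refl)))) (var here)) (hyp (here refl)))

  instanceφ : Der T _ Δx (memF (var here) (var (there here)) ⊃ renF wkUnder φ)
  instanceφ = subst (Der T _ Δx)
    (cong₂ _⊃_ (wkUnder-instantiate (memF (var here) (var (there here))))
               (wkUnder-instantiate (renF wkUnder φ)))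
    (∀E (hyp (there (here refl))) (var here))

hyper⇒hgmpMatrix : ∀ {T} (φ : Fm (σ ∷ Γ)) (ψ : Fm Γ) →
  Der T (σ * ∷ Γ) (wkF (∀st σ φ ⊃ ψ) ∷ []) (hyperF σ (var here) ⊃ hgmpMatrix σ φ ψ)
hyper⇒hgmpMatrix φ ψ =
  ⊃I (⊃I (⊃E (hyp (there (there (here refl)))) (hyper-bounded⇒standard φ)))

mainTheorem3 : ∀ {Γ : Ctx} (σ : Ty) (φ : Fm (σ ∷ Γ)) (ψ : Fm Γ) →
    Internal φ → Internal ψ → Der EHAst+US Γ [] (HGMPst σ φ ψ)
mainTheorem3 σ φ ψ iφ iψ =
  ⊃I (⊃E (ax (US* (hgmpMatrix σ φ ψ) (hgmpMatrix-int iφ iψ)))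
         (∀I (hyper⇒hgmpMatrix φ ψ)))
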